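{- Let $\mathsf{F}$ and $E$ be number fields and let $\mathcal{M}$, $\mathcal{N}$ be pure motives defined over $\mathsf{F}$ with coefficients in $E$. Assume that $t^{\mathcal{M}_{\tau,\sigma}} = t^{\mathcal{N}_{\tau,\sigma}}+1$ for every $\tau\in I_{\mathsf{F}}$ and $\sigma\in I_E$. Fix an archimedean place of $\mathsf{F}$, represented by an embedding $\tau\in I_{\mathsf{F}}$, and $\sigma\in I_E$; put $t_{\tau,\sigma}:=t^{\mathcal{N}_{\tau,\sigma}}$. Suppose that $\mathcal{M}$ and $\mathcal{N}$ satisfy the strong interlace condition at $\tau$ and $\sigma$, i.e. there is an integer $Q$ such that for $i=1,2,\dots,t_{\tau,\sigma}$: \[ -\min\{ p_{t_{\tau,\sigma}+2-i}^{\mathcal{M}_{\tau,\sigma}}, q_{i}^{\mathcal{M}_{\tau,\sigma}}\} < \min\{ p_i^{\mathcal{N}_{\tau,\sigma}}, q_{t_{\tau,\sigma}+1-i}^{\mathcal{N}_{\tau,\sigma}} \} +Q, \qquad \max\{ p_i^{\mathcal{N}_{\tau,\sigma}}, q_{t_{\tau,\sigma}+1-i}^{\mathcal{N}_{\tau,\sigma}} \} +Q \leq - \max\{ p_{t_{\tau,\sigma}+1-i}^{\mathcal{M}_{\tau,\sigma}}, q_{i+1}^{\mathcal{M}_{\tau,\sigma}}\}. \] Let $\mathcal{H}$ be the multiset (counted with multiplicity over the indices) \[ \mathcal{H}=\left\{ \left(p_i^{\mathcal{M}_{\tau,\sigma}}+p_j^{\mathcal{N}_{\tau,\sigma}},\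 q_i^{\mathcal{M}_{\tau,\sigma}}+q_j^{\mathcal{N}_{\tau,\sigma}}\right) \,\middle|\, 1\leq i\leq t_{\tau,\sigma}+1,\ 1\leq j\leq t_{\tau,\sigma} \right\} \] if $\tau$ is real, and \[ \mathcal{H}=\left\{ \left(p_i^{\mathcal{M}_{\tilde{\tau},\sigma}}+p_j^{\mathcal{N}_{\tilde{\tau}',\sigma}},\ q_i^{\mathcal{M}_{\tilde{\tau},\sigma}}+q_j^{\mathcal{N}_{\tilde{\tau}',\sigma}}\right) \,\middle|\, 1\leq i\leq t_{\tau,\sigma}+1,\ 1\leq j\leq t_{\tau,\sigma},\ \tilde{\tau},\tilde{\tau}'\in \{\tau, \rho\tau\} \right\} \] if $\tau$ is complex. Define \[ q_{\tau,\sigma}=\min \left\{ p^{\mathcal{M}_{\tilde{\tau},\sigma}}_{t_{\tau,\sigma}+2- i} + p^{\mathcal{N}_{\tilde{\tau}',\sigma}}_{i} \,\middle|\, 1 \leq i \leq t_{\tau,\sigma},\ \tilde{\tau}, \tilde{\tau}'\in \{\tau, \rho\tau \} \right\}. \] Then the sub-multisets $\mathcal{H}_{<q_{\tau,\sigma}}=\{(p,q)\in\mathcal{H}\mid p<q_{\tau,\sigma}\}$ and $\mathcal{H}_{\geq q_{\tau,\sigma}}=\{(p,q)\in\mathcal{H}\mid p\geq q_{\tau,\sigma}\}$ form a partition of $\mathcal{H}$ into two sub-multisets of equal cardinality (counted with multiplicity).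
   Context: All number fields are regarded as subfields of $\mathbf{C}$; $\rho$ denotes complex conjugation, $I_{\mathsf{F}}$ (resp. $I_E$) is the set of embeddings of $\mathsf{F}$ (resp. $E$) into $\mathbf{C}$; archimedean places are identified with embeddings by choosing one of the two embeddings for each complex place (for real $\tau$, $\rho\tau=\tau$). A pure motive $\bullet$ of weight $\mathsf{w}$ over $\mathsf{F}$ with coefficients in $E$ has, for each $\tau\in I_{\mathsf{F}}$, a Betti realization $H_{\rm B}(\bullet_\tau)$ (a finite-dimensional $E$-vector space of the base change $\bullet_\tau$ of $\bullet$ along $\tau$) with a Hodge decomposition $H_{\rm B}(\bullet_\tau)\otimes_{\mathbf Q}\mathbf C=\bigoplus_{p+q=\mathsf{w}}H^{p,q}(\bullet_\tau)$ into $E\otimes_{\mathbf{Q}}\mathbf{C}$-modules, and an $E$-linear isomorphism $F_{\infty,\tau}\colon H_{\rm B}(\bullet_\tau)\to H_{\rm B}(\bullet_{\rho\tau})$ (induced by complex conjugation, with inverse $F_{\infty,\rho\tau}$) such that $F_{\infty,\tau}\otimes\mathrm{id}$ maps $H^{p,q}(\bullet_\tau)$ isomorphically onto $H^{q,p}(\bullet_{\rho\tau})$. For $\sigma\in I_E$, write $H_{\rm B}(\bullet_\tau)\otimes_{E,\sigma}\mathbf{C}=\bigoplus_{i=1}^{t^{\bullet_{\tau,\sigma}}}H^{p_i^{\bullet_{\tau,\sigma}},q_i^{\bullet_{\tau,\sigma}}}(\bullet_\tau)_\sigma$, where every listed component is nonzero, $p^{\bullet_{\tau,\sigma}}_i+q^{\bullet_{\tau,\sigma}}_i=\mathsf{w}$,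 and $p_1^{\bullet_{\tau,\sigma}}<p_2^{\bullet_{\tau,\sigma}}<\cdots<p_{t^{\bullet_{\tau,\sigma}}}^{\bullet_{\tau,\sigma}}$; here $t^{\bullet_{\tau,\sigma}}$ is the number of distinct Hodge types. -}

module Defs where

open import Data.Nat as ℕ using (ℕ; zero; suc; _∸_)
open import Data.Fin as Fin using (Fin; fromℕ<)
open import Data.Integer as ℤ using (ℤ; _-_; _+_; _⊓_; _⊔_; -_; _<_; _≤_; _<?_; _≤?_; 0ℤ)
open import Data.List using (List; []; _∷_; map; concatMap; filter; length; foldr; upTo)
open import Data.Product using (_×_; _,_; proj₁; ∃)
open import Function.Bundles using (_⇔_)
open import Relation.Binary.PropositionalEquality using (_≡_)
open import Relation.Nullary using (yes; no)

-- Hodge-theoretic data of a pure motive over F with coefficients in E,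
-- as far as it enters the statement.  IF = I_F (embeddings of F),
-- IE = I_E (embeddings of E), ρ = complex conjugation acting on I_F.
-- For τ ∈ I_F, σ ∈ I_E: t τ σ = t^{•_{τ,σ}} (number of distinct Hodge types
-- occurring in H_B(•_τ) ⊗_{E,σ} C), p τ σ i = p_{i+1} (0-based Fin index),
-- strictly increasing, q_i = w - p_i.
record PureMotive (IF IE : Set) (ρ : IF → IF) : Set where
  field
    w        : ℤ
    t        : IF → IE → ℕ
    p        : (τ : IF) (σ : IE) → Fin (t τ σ) → ℤ
    p-strict : ∀ τ σ (i j : Fin (t τ σ)) → i Fin.< j → p τ σ i < p τ σ j
  q : (τ : IF) (σ : IE) → Fin (t τ σ) → ℤ
  q τ σ i = w - p τ σ i
  field
    -- F_∞ ⊗ id maps H^{a,b}(•_τ)_σ isomorphically onto H^{b,a}(•_{ρτ})_σ: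
    -- the Hodge type (a,b) occurs at (ρτ,σ) iff (b,a) occurs at (τ,σ).
    conj : ∀ τ σ (a b : ℤ) →
      (∃ λ (i : Fin (t (ρ τ) σ)) → (p (ρ τ) σ i , q (ρ τ) σ i) ≡ (a , b))
      ⇔ (∃ λ (i : Fin (t τ σ)) → (p τ σ i , q τ σ i) ≡ (b , a))

-- 1-based access to a finite sequence; value 0 outside 1..n (never used
-- under the hypotheses of the lemma).
at : ∀ {n} → (Fin n → ℤ) → ℕ → ℤ
at f zero = 0ℤ
at {n} f (suc k) with k ℕ.<? n
... | yes k<n = f (fromℕ< k<n)
... | no _ = 0ℤ

module _ {IF IE : Set} {ρ : IF → IF} where
  open PureMotive

  P Q : PureMotive IF IE ρ → IF → IE → ℕ → ℤ
  P X τ σ k = at (p X τ σ) k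
  Q X τ σ k = at (q X τ σ) k

range1 : ℕ → List ℕ
range1 n = map suc (upTo n)

-- minimum of a list of integers (0 for the empty list; only occurs when t = 0,
-- in which case H is empty and the value is irrelevant)
minList : List ℤ → ℤ
minList [] = 0ℤ
minList (x ∷ xs) = foldr _⊓_ x xs

module _ {IF IE : Set} {ρ : IF → IF} (M N : PureMotive IF IE ρ) (τ : IF) (σ : IE) where
  open PureMotive

  tN : ℕ
  tN = t N τ σ

  StrongInterlace : Set
  StrongInterlace = ∃ λ (Q₀ : ℤ) → ∀ (i : ℕ) → 1 ℕ.≤ i → i ℕ.≤ tN →
      (- (P M τ σ (2 ℕ.+ tN ∸ i) ⊓ Q M τ σ i) < (P N τ σ i ⊓ Q N τ σ (1 ℕ.+ tN ∸ i)) + Q₀)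
    × ((P N τ σ i ⊔ Q N τ σ (1 ℕ.+ tN ∸ i)) + Q₀ ≤ - (P M τ σ (1 ℕ.+ tN ∸ i) ⊔ Q M τ σ (suc i)))

  -- the multiset H, as a list (multiplicity = number of index tuples),
  -- with τ̃, τ̃' ranging over the given list of embeddings
  Hover : List IF → List (ℤ × ℤ)
  Hover embs =
    concatMap (λ τ₁ → concatMap (λ τ₂ →
      concatMap (λ i → map (λ j →
        (P M τ₁ σ i + P N τ₂ σ j , Q M τ₁ σ i + Q N τ₂ σ j))
        (range1 tN)) (range1 (suc tN))) embs) embs

  Hreal Hcomplex : List (ℤ × ℤ)
  Hreal = Hover (τ ∷ [])
  Hcomplex = Hover (τ ∷ ρ τ ∷ [])

  qτσ : ℤ
  qτσ = minList (concatMap (λ τ₁ → concatMap (λ τ₂ → map (λ i →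
          P M τ₁ σ (2 ℕ.+ tN ∸ i) + P N τ₂ σ i) (range1 tN))
          (τ ∷ ρ τ ∷ [])) (τ ∷ ρ τ ∷ []))

  H<q H≥q : List (ℤ × ℤ) → List (ℤ × ℤ)
  H<q H = filter (λ h → proj₁ h <? qτσ) H
  H≥q H = filter (λ h → qτσ ≤? proj₁ h) H

  EqualSplit : List (ℤ × ℤ) → Set
  EqualSplit H = (length (H<q H) ℕ.+ length (H≥q H) ≡ length H)
               × (length (H<q H) ≡ length (H≥q H))

-- Every block of H (one for each choice of τ̃, τ̃') is a (t+1) × t grid of sums m_i + n_j with m
-- increasing: m, n are the p's at τ̃, τ̃', and by F_∞ the p's at ρτ are the reflected q's at τ.
-- Strong interlacing, read through this reflection for all four choices of embeddings, puts the
-- anti-diagonal sums m_{t+1−j} + n_j at or below −Q and the sums m_{t+2−j} + n_j above −Q.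
-- Hence q_{τ,σ}, the minimum of the latter, cuts each block along the anti-diagonal i + j = t + 1
-- into halves of t(t+1)/2 entries.
module Submission where

open import Defs
open import Data.Nat as ℕ using (ℕ; zero; suc; _∸_; _⊓_; z≤n; s≤s)
import Data.Nat.Properties as ℕP
open import Data.Nat.Induction using (<-rec)
open import Data.Nat.ListAction using (sum)
open import Data.Nat.ListAction.Properties using (sum-↭)
open import Data.Fin as Fin using (Fin; fromℕ<; toℕ)
import Data.Fin.Properties as FinP
open import Data.Integer as ℤ using (ℤ; _+_; _-_; -_; _<_; _≤_; _<?_; _≤?_)
import Data.Integer.Properties as ℤP
open import Data.Integer.Solver using (module +-*-Solver)
open import Data.List using (List; []; _∷_; map; concatMap; filter; length; upTo; applyUpTo; downFrom; reverse)
open import Data.List.Properties using (filter-++; filter-none; length-++; length-map; length-upTo; map-upTo; map-∘; map-cong-local; map-id; reverse-upTo; foldr-preservesᵒ; foldr-preservesᵇ)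
open import Data.List.Relation.Unary.All as All using (All; []; _∷_)
import Data.List.Relation.Unary.All.Properties as AllP
open import Data.List.Relation.Unary.Any using (here; there)
import Data.List.Relation.Unary.Any as Any
open import Data.List.Membership.Propositional using (_∈_; lose)
open import Data.List.Membership.Propositional.Properties using (∈-map⁺; ∈-upTo⁺; ∈-concatMap⁺)
open import Data.List.Relation.Binary.Permutation.Propositional.Properties using (↭-reverse)
open import Data.Product using (_×_; _,_; proj₁; proj₂; ∃-syntax)
open import Data.Sum using (_⊎_; inj₁; inj₂; [_,_]′)
open import Data.Empty using (⊥-elim)
open import Function using (_∘_; id; _⇔_; Equivalence; mk⇔)
open import Relation.Binary.PropositionalEquality using (_≡_; _≢_; refl; sym; trans; cong; cong₂; subst; subst₂; module ≡-Reasoning)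
open import Relation.Nullary using (¬_; yes; no)
open import Relation.Unary using (Pred; Decidable; _⊆_)
open import Level using (0ℓ)

private variable
  A B : Set

m<n∸o⇒o<n∸m : ∀ {m n o} → o ℕ.≤ n → m ℕ.< n ∸ o → o ℕ.< n ∸ m
m<n∸o⇒o<n∸m {m} {n} {o} o≤n m<n∸o = ℕP.m+n≤o⇒m≤o∸n (suc o)
  (subst (ℕ._≤ n) (cong suc (ℕP.+-comm m o)) (ℕP.m≤o∸n⇒m+n≤o (suc m) o≤n m<n∸o))

n∸o≤m⇒1+n∸m≤1+o : ∀ {m n o} → n ∸ o ℕ.≤ m → suc n ∸ m ℕ.≤ suc o
n∸o≤m⇒1+n∸m≤1+o {m} {n} {o} n∸o≤m = ℕP.m≤n+o⇒m∸n≤o (suc n) m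
  (subst (suc n ℕ.≤_) (trans (cong suc (ℕP.+-comm o m)) (sym (ℕP.+-suc m o)))
    (s≤s (ℕP.≤-trans (ℕP.m≤n+m∸n n o) (ℕP.+-monoʳ-≤ o n∸o≤m))))

suc[m]∸[m∸n]≡suc[n] : ∀ {m n} → n ℕ.≤ m → suc m ∸ (m ∸ n) ≡ suc n
suc[m]∸[m∸n]≡suc[n] {m} {n} n≤m = trans (ℕP.+-∸-assoc 1 (ℕP.m∸n≤m m n)) (cong suc (ℕP.m∸[m∸n]≡n n≤m))

x≡y⊎x≡z⇒y⊓z≤x : ∀ {x y z} → x ≡ y ⊎ x ≡ z → y ℤ.⊓ z ≤ x
x≡y⊎x≡z⇒y⊓z≤x (inj₁ refl) = ℤP.i⊓j≤i _ _
x≡y⊎x≡z⇒y⊓z≤x (inj₂ refl) = ℤP.i⊓j≤j _ _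

x≡y⊎x≡z⇒x≤y⊔z : ∀ {x y z} → x ≡ y ⊎ x ≡ z → x ≤ y ℤ.⊔ z
x≡y⊎x≡z⇒x≤y⊔z (inj₁ refl) = ℤP.i≤i⊔j _ _
x≡y⊎x≡z⇒x≤y⊔z (inj₂ refl) = ℤP.i≤j⊔i _ _

module _ {a b c : ℤ} where
  open +-*-Solver

  b+c≤-a⇒a+b≤-c : b + c ≤ - a → a + b ≤ - c
  b+c≤-a⇒a+b≤-c b+c≤-a = subst₂ _≤_
    (solve 3 (λ a b c → (b :+ c) :+ (a :+ :- c) := a :+ b) refl a b c)
    (solve 3 (λ a b c → (:- a) :+ (a :+ :- c) := :- c) refl a b c)
    (ℤP.+-monoˡ-≤ (a - c) b+c≤-a)

  -a<b+c⇒-c<a+b : - a < b + c → - c < a + b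
  -a<b+c⇒-c<a+b -a<b+c = subst₂ _<_
    (solve 3 (λ a b c → (:- a) :+ (a :+ :- c) := :- c) refl a b c)
    (solve 3 (λ a b c → (b :+ c) :+ (a :+ :- c) := a :+ b) refl a b c)
    (ℤP.+-monoˡ-< (a - c) -a<b+c)

minList-≤ : ∀ {x xs} → x ∈ xs → minList xs ≤ x
minList-≤ {x} {y ∷ ys} x∈xs = foldr-preservesᵒ
  (λ a b → [ ℤP.i≤j⇒i⊓k≤j b , ℤP.i≤j⇒k⊓i≤j a ]′)
  y ys (located x∈xs)
  where
  located : x ∈ y ∷ ys → y ≤ x ⊎ Any.Any (_≤ x) ys
  located (here refl) = inj₁ ℤP.≤-refl
  located (there x∈ys) = inj₂ (Any.map (λ { refl → ℤP.≤-refl }) x∈ys)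

-- The membership only excludes the empty list, on which minList is 0.
<-minList : ∀ {c x xs} → x ∈ xs → All (c <_) xs → c < minList xs
<-minList {c} {xs = y ∷ ys} _ (c<y ∷ c<ys) = foldr-preservesᵇ c<⊓ c<y c<ys
  where
  c<⊓ : ∀ {a b} → c < a → c < b → c < a ℤ.⊓ b
  c<⊓ {a} {b} c<a c<b with ℤP.⊓-sel a b
  ... | inj₁ a⊓b≡a = subst (c <_) (sym a⊓b≡a) c<a
  ... | inj₂ a⊓b≡b = subst (c <_) (sym a⊓b≡b) c<b

length-filter-complement : {P Q : Pred A 0ℓ} (P? : Decidable P) (Q? : Decidable Q) →
  (∀ {x} → P x → ¬ Q x) → (∀ {x} → ¬ P x → Q x) →
  ∀ xs → length (filter P? xs) ℕ.+ length (filter Q? xs) ≡ length xs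
length-filter-complement P? Q? P⇒¬Q ¬P⇒Q [] = refl
length-filter-complement P? Q? P⇒¬Q ¬P⇒Q (x ∷ xs) with P? x | Q? x
... | yes px  | yes qx  = ⊥-elim (P⇒¬Q px qx)
... | yes _   | no _    = cong suc (length-filter-complement P? Q? P⇒¬Q ¬P⇒Q xs)
... | no _    | yes _   = trans (ℕP.+-suc _ _) (cong suc (length-filter-complement P? Q? P⇒¬Q ¬P⇒Q xs))
... | no ¬px  | no ¬qx  = ⊥-elim (¬qx (¬P⇒Q ¬px))

length-filter-map : {P : Pred B 0ℓ} {Q : Pred A 0ℓ} (P? : Decidable P) (Q? : Decidable Q) (f : A → B) →
  ∀ xs → All (λ x → P (f x) ⇔ Q x) xs → length (filter P? (map f xs)) ≡ length (filter Q? xs)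
length-filter-map P? Q? f [] [] = refl
length-filter-map P? Q? f (x ∷ xs) (Pfx⇔Qx ∷ rest) with P? (f x) | Q? x
... | yes _    | yes _   = cong suc (length-filter-map P? Q? f xs rest)
... | yes pfx  | no ¬qx  = ⊥-elim (¬qx (Equivalence.to Pfx⇔Qx pfx))
... | no ¬pfx  | yes qx  = ⊥-elim (¬pfx (Equivalence.from Pfx⇔Qx qx))
... | no _     | no _    = length-filter-map P? Q? f xs rest

length-filter-concatMap : {P : Pred B 0ℓ} (P? : Decidable P) (f : A → List B) → ∀ xs →
  length (filter P? (concatMap f xs)) ≡ sum (map (length ∘ filter P? ∘ f) xs)
length-filter-concatMap P? f [] = refl
length-filter-concatMap P? f (x ∷ xs) =
  trans (cong length (filter-++ P? (f x) (concatMap f xs)))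
    (trans (length-++ (filter P? (f x)))
      (cong (length (filter P? (f x)) ℕ.+_) (length-filter-concatMap P? f xs)))

All-concatMap⁺ : {P : Pred B 0ℓ} (f : A → List B) (xs : List A) →
  (∀ {x} → x ∈ xs → All P (f x)) → All P (concatMap f xs)
All-concatMap⁺ f xs Pf = AllP.concat⁺ (AllP.map⁺ (All.tabulate Pf))

All-range1⁺ : {P : Pred ℕ 0ℓ} → ∀ n → (∀ {k} → k ℕ.< n → P (suc k)) → All P (range1 n)
All-range1⁺ n Psuc = AllP.map⁺ (AllP.applyUpTo⁺₁ id n Psuc)

∈-range1⁺ : ∀ {n k} → k ℕ.< n → suc k ∈ range1 n
∈-range1⁺ k<n = ∈-map⁺ suc (∈-upTo⁺ k<n)

length-range1 : ∀ n → length (range1 n) ≡ n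
length-range1 n = trans (length-map suc (upTo n)) (length-upTo n)

range1-suc : ∀ n → range1 (suc n) ≡ 1 ∷ map suc (range1 n)
range1-suc n = cong (λ l → 1 ∷ map suc l) (sym (map-upTo suc n))

length-filter-≤-range1 : ∀ n K → length (filter (ℕ._≤? K) (range1 n)) ≡ n ⊓ K
length-filter-≤-range1 n zero =
  trans (cong length (filter-none (ℕ._≤? 0) (All-range1⁺ n λ _ ()))) (sym (ℕP.⊓-zeroʳ n))
length-filter-≤-range1 zero (suc K) = refl
length-filter-≤-range1 (suc n) (suc K) =
  trans (cong (length ∘ filter (ℕ._≤? suc K)) (range1-suc n))
    (cong suc (trans (length-filter-map (ℕ._≤? suc K) (ℕ._≤? K) suc (range1 n)
                        (All.universal (λ _ → mk⇔ ℕP.≤-pred s≤s) _))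
                     (length-filter-≤-range1 n K)))

applyUpTo-reflect : ∀ n → applyUpTo (λ k → n ∸ suc k) n ≡ downFrom n
applyUpTo-reflect zero = refl
applyUpTo-reflect (suc n) = cong (n ∷_) (applyUpTo-reflect n)

sum-map-∸-range1 : ∀ n → sum (map (n ∸_) (range1 n)) ≡ sum (map (_∸ 1) (range1 n))
sum-map-∸-range1 n = begin
  sum (map (n ∸_) (map suc (upTo n)))    ≡⟨ cong sum (sym (map-∘ (upTo n))) ⟩
  sum (map (λ k → n ∸ suc k) (upTo n))   ≡⟨ cong sum (map-upTo _ n) ⟩
  sum (applyUpTo (λ k → n ∸ suc k) n)    ≡⟨ cong sum (applyUpTo-reflect n) ⟩
  sum (downFrom n)                       ≡⟨ cong sum (sym (reverse-upTo n)) ⟩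
  sum (reverse (upTo n))                 ≡⟨ sum-↭ (↭-reverse (upTo n)) ⟩
  sum (upTo n)                           ≡⟨ cong sum (sym (map-id (upTo n))) ⟩
  sum (map ((_∸ 1) ∘ suc) (upTo n))      ≡⟨ cong sum (map-∘ (upTo n)) ⟩
  sum (map (_∸ 1) (map suc (upTo n)))    ∎
  where open ≡-Reasoning

StrictlyIncreasingOn MonotoneOn : ℕ → (ℕ → ℤ) → Set
StrictlyIncreasingOn n f = ∀ {i j} → 1 ℕ.≤ i → i ℕ.< j → j ℕ.≤ n → f i < f j
MonotoneOn n f = ∀ {i j} → 1 ℕ.≤ i → i ℕ.≤ j → j ℕ.≤ n → f i ≤ f j

strictlyIncreasing⇒monotone : ∀ {n f} → StrictlyIncreasingOn n f → MonotoneOn n f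
strictlyIncreasing⇒monotone f↑ 1≤i i≤j j≤n with ℕP.m≤n⇒m<n∨m≡n i≤j
... | inj₁ i<j  = ℤP.<⇒≤ (f↑ 1≤i i<j j≤n)
... | inj₂ refl = ℤP.≤-refl

ValuesOn : ℕ → (ℕ → ℤ) → Pred ℤ 0ℓ
ValuesOn n f v = ∃[ i ] 1 ℕ.≤ i × i ℕ.≤ n × f i ≡ v

catch-up : ∀ {n m f g} → StrictlyIncreasingOn n f → MonotoneOn m g →
  ∀ {i} → (∀ {j} → 1 ℕ.≤ j → j ℕ.< i → f j ≡ g j) → 1 ℕ.≤ i → i ℕ.≤ n →
  ValuesOn m g (f i) → i ℕ.≤ m × g i ≤ f i
catch-up {g = g} f↑ g-mono {i} agree 1≤i i≤n (j , 1≤j , j≤m , gj≡fi) =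
  ℕP.≤-trans i≤j j≤m , subst (g i ≤_) gj≡fi (g-mono 1≤i i≤j j≤m)
  where
  -- a value g j = f i with j < i would equal f j, contradicting strictness of f
  i≤j : i ℕ.≤ j
  i≤j = ℕP.≮⇒≥ (λ j<i → ℤP.<⇒≢ (f↑ 1≤j j<i i≤n) (trans (agree 1≤j j<i) gj≡fi))

module _ {n m : ℕ} {f g : ℕ → ℤ} (f↑ : StrictlyIncreasingOn n f) (g↑ : StrictlyIncreasingOn m g) where

  strictlyIncreasing-unique : ValuesOn n f ⊆ ValuesOn m g → ValuesOn m g ⊆ ValuesOn n f →
    ∀ {i} → 1 ℕ.≤ i → i ℕ.≤ n → i ℕ.≤ m × f i ≡ g i
  strictlyIncreasing-unique f⊆g g⊆f {i} = <-rec Agree step i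
    where
    Agree : ℕ → Set
    Agree i = 1 ℕ.≤ i → i ℕ.≤ n → i ℕ.≤ m × f i ≡ g i
    step : ∀ i → (∀ {j} → j ℕ.< i → Agree j) → Agree i
    step i rec 1≤i i≤n = i≤m , ℤP.≤-antisym fi≤gi gi≤fi
      where
      agree : ∀ {j} → 1 ℕ.≤ j → j ℕ.< i → f j ≡ g j
      agree 1≤j j<i = proj₂ (rec j<i 1≤j (ℕP.≤-trans (ℕP.<⇒≤ j<i) i≤n))
      f-side : i ℕ.≤ m × g i ≤ f i
      f-side = catch-up f↑ (strictlyIncreasing⇒monotone g↑) agree 1≤i i≤n (f⊆g (i , 1≤i , i≤n , refl))
      i≤m : i ℕ.≤ m
      i≤m = proj₁ f-side
      gi≤fi : g i ≤ f i
      gi≤fi = proj₂ f-side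
      fi≤gi : f i ≤ g i
      fi≤gi = proj₂ (catch-up g↑ (strictlyIncreasing⇒monotone f↑) (λ 1≤j j<i → sym (agree 1≤j j<i))
                       1≤i i≤m (g⊆f (i , 1≤i , i≤m , refl)))

module _ (q : ℤ) where

  count< count≥ : List (ℤ × A) → ℕ
  count< xs = length (filter (λ h → proj₁ h <? q) xs)
  count≥ xs = length (filter (λ h → q ≤? proj₁ h) xs)

  Balanced : List (ℤ × A) → Set
  Balanced xs = count< xs ≡ count≥ xs

  count<+count≥ : (xs : List (ℤ × A)) → count< xs ℕ.+ count≥ xs ≡ length xs
  count<+count≥ = length-filter-complement _ _ (λ h<q q≤h → ℤP.<⇒≱ h<q q≤h) ℤP.≮⇒≥

  concatMap-balanced : (f : B → List (ℤ × A)) → ∀ xs → All (Balanced ∘ f) xs → Balanced (concatMap f xs)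
  concatMap-balanced f xs balanced =
    trans (length-filter-concatMap _ f xs)
      (trans (cong sum (map-cong-local balanced)) (sym (length-filter-concatMap _ f xs)))

gridRow : (b : ℕ) (m n : ℕ → ℤ) (r : ℕ → ℕ → A) → ℕ → List (ℤ × A)
gridRow b m n r i = map (λ j → (m i + n j , r i j)) (range1 b)

grid : (a b : ℕ) (m n : ℕ → ℤ) (r : ℕ → ℕ → A) → List (ℤ × A)
grid a b m n r = concatMap (gridRow b m n r) (range1 a)

-- Entry (i, j) lies below q exactly when i + j ≤ t + 1, so row i has t + 1 − i entries
-- below q and i − 1 at or above it; the two totals agree by reversing the order of the rows.
module _ {t : ℕ} {q : ℤ} {m n : ℕ → ℤ} (r : ℕ → ℕ → A) (m↑ : MonotoneOn (suc t) m)
  (separated : ∀ {k} → k ℕ.< t → m (t ∸ k) + n (suc k) < q × q ≤ m (suc t ∸ k) + n (suc k)) where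

  private
    row : ℕ → List (ℤ × A)
    row = gridRow t m n r

  entry-below : ∀ {i k} → i ℕ.≤ t → k ℕ.< t → suc k ℕ.≤ t ∸ i → m (suc i) + n (suc k) < q
  entry-below {k = k} i≤t k<t k<t∸i = ℤP.≤-<-trans
    (ℤP.+-monoˡ-≤ _ (m↑ (s≤s z≤n) (m<n∸o⇒o<n∸m i≤t k<t∸i) (ℕP.m≤n⇒m≤1+n (ℕP.m∸n≤m t k))))
    (proj₁ (separated k<t))

  entry-atLeast : ∀ {i k} → i ℕ.≤ t → k ℕ.< t → t ∸ i ℕ.≤ k → q ≤ m (suc i) + n (suc k)
  entry-atLeast i≤t k<t t∸i≤k = ℤP.≤-trans (proj₂ (separated k<t))
    (ℤP.+-monoˡ-≤ _ (m↑ (ℕP.m<n⇒0<n∸m (ℕP.m<n⇒m<1+n k<t)) (n∸o≤m⇒1+n∸m≤1+o t∸i≤k) (s≤s i≤t)))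

  entry<⇔ : ∀ {i k} → i ℕ.≤ t → k ℕ.< t → (m (suc i) + n (suc k) < q) ⇔ (suc k ℕ.≤ t ∸ i)
  entry<⇔ i≤t k<t = mk⇔
    (λ entry<q → ℕP.≰⇒> (λ t∸i≤k → ℤP.<⇒≱ entry<q (entry-atLeast i≤t k<t t∸i≤k)))
    (entry-below i≤t k<t)

  row-count< : ∀ {i} → i ℕ.≤ t → count< q (row (suc i)) ≡ t ∸ i
  row-count< {i} i≤t = begin
    count< q (row (suc i))                           ≡⟨ length-filter-map _ (ℕ._≤? (t ∸ i)) _ (range1 t)
                                                          (All-range1⁺ t (entry<⇔ i≤t)) ⟩
    length (filter (ℕ._≤? (t ∸ i)) (range1 t))     ≡⟨ length-filter-≤-range1 t (t ∸ i) ⟩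
    t ⊓ (t ∸ i)                                      ≡⟨ ℕP.m≥n⇒m⊓n≡n (ℕP.m∸n≤m t i) ⟩
    t ∸ i                                            ∎
    where open ≡-Reasoning

  row-count≥ : ∀ {i} → i ℕ.≤ t → count≥ q (row (suc i)) ≡ i
  row-count≥ {i} i≤t = begin
    count≥ q (row (suc i))                                       ≡⟨ ℕP.m+n∸m≡n (count< q (row (suc i))) _ ⟨
    count< q (row (suc i)) ℕ.+ count≥ q (row (suc i)) ∸ count< q (row (suc i))
                                                                 ≡⟨ cong₂ _∸_ row-length (row-count< i≤t) ⟩
    t ∸ (t ∸ i)                                                  ≡⟨ ℕP.m∸[m∸n]≡n i≤t ⟩
    i                                                            ∎
    where
    open ≡-Reasoning
    row-length : count< q (row (suc i)) ℕ.+ count≥ q (row (suc i)) ≡ t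
    row-length = trans (count<+count≥ q (row (suc i))) (trans (length-map _ (range1 t)) (length-range1 t))

  grid-balanced : Balanced q (grid (suc t) t m n r)
  grid-balanced = begin
    count< q (concatMap row (range1 (suc t)))        ≡⟨ length-filter-concatMap _ row (range1 (suc t)) ⟩
    sum (map (count< q ∘ row) (range1 (suc t)))      ≡⟨ cong sum (map-cong-local (All-range1⁺ (suc t)
                                                          (λ k<1+t → row-count< (ℕP.≤-pred k<1+t)))) ⟩
    sum (map (suc t ∸_) (range1 (suc t)))            ≡⟨ sum-map-∸-range1 (suc t) ⟩
    sum (map (_∸ 1) (range1 (suc t)))                ≡⟨ cong sum (map-cong-local {f = count≥ q ∘ row} {g = _∸ 1}
                                                          (All-range1⁺ (suc t) (λ k<1+t → row-count≥ (ℕP.≤-pred k<1+t)))) ⟨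
    sum (map (count≥ q ∘ row) (range1 (suc t)))      ≡⟨ length-filter-concatMap _ row (range1 (suc t)) ⟨
    count≥ q (concatMap row (range1 (suc t)))        ∎
    where open ≡-Reasoning

module _ {n : ℕ} (f : Fin n → ℤ) where

  at-suc : ∀ {k} (k<n : k ℕ.< n) → at f (suc k) ≡ f (fromℕ< k<n)
  at-suc {k} k<n with k ℕ.<? n
  ... | yes _ = refl
  ... | no k≮n = ⊥-elim (k≮n k<n)

  at-toℕ : ∀ i → at f (suc (toℕ i)) ≡ f i
  at-toℕ i = trans (at-suc (FinP.toℕ<n i)) (cong f (FinP.fromℕ<-toℕ i (FinP.toℕ<n i)))

  at-onto : ∀ {i} → 1 ℕ.≤ i → i ℕ.≤ n → ∃[ j ] at f i ≡ f j
  at-onto {suc k} _ k<n = fromℕ< k<n , at-suc k<n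

  at-strictlyIncreasing : (∀ i j → i Fin.< j → f i < f j) → StrictlyIncreasingOn n (at f)
  at-strictlyIncreasing f↑ {suc i} {suc j} _ (s≤s i<j) j<n =
    subst₂ _<_ (sym (at-suc i<n)) (sym (at-suc j<n))
      (f↑ _ _ (subst₂ ℕ._<_ (sym (FinP.toℕ-fromℕ< i<n)) (sym (FinP.toℕ-fromℕ< j<n)) i<j))
    where
    i<n : i ℕ.< n
    i<n = ℕP.<-trans i<j j<n

at-∘ : ∀ {n} (g : ℤ → ℤ) (f : Fin n → ℤ) {k} → k ℕ.< n → at (g ∘ f) (suc k) ≡ g (at f (suc k))
at-∘ g f k<n = trans (at-suc (g ∘ f) k<n) (cong g (sym (at-suc f k<n)))

module _ {IF IE : Set} {ρ : IF → IF} (X : PureMotive IF IE ρ) (σ : IE) where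
  open PureMotive X

  P-strictlyIncreasing : ∀ τ → StrictlyIncreasingOn (t τ σ) (P X τ σ)
  P-strictlyIncreasing τ = at-strictlyIncreasing (p τ σ) (p-strict τ σ)

  Q≡w-P : ∀ {τ i} → 1 ℕ.≤ i → i ℕ.≤ t τ σ → Q X τ σ i ≡ w - P X τ σ i
  Q≡w-P {τ} {suc k} _ k<n = at-∘ (λ x → w - x) (p τ σ) k<n

  -- conj makes the Hodge types at ρτ the transposes of those at τ; both sequences being
  -- strictly increasing, p at ρτ is the reflected sequence i ↦ w − p_{n+1−i} at τ.
  module _ (τ : IF) where

    private
      n : ℕ
      n = t τ σ

      reflected : ℕ → ℤ
      reflected i = w - P X τ σ (suc n ∸ i)

      reflected-strictlyIncreasing : StrictlyIncreasingOn n reflected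
      reflected-strictlyIncreasing {suc i} {j} _ i<j j≤n = ℤP.+-monoʳ-< w (ℤP.neg-mono-<
        (P-strictlyIncreasing τ (ℕP.m<n⇒0<n∸m (s≤s j≤n)) (ℕP.∸-monoʳ-< i<j (ℕP.m≤n⇒m≤1+n j≤n))
          (ℕP.m∸n≤m n i)))

      reflected⊆P[ρτ] : ValuesOn n reflected ⊆ ValuesOn (t (ρ τ) σ) (P X (ρ τ) σ)
      reflected⊆P[ρτ] (suc k , _ , k<n , refl) with at-onto (p τ σ) (ℕP.m<n⇒0<n∸m k<n) (ℕP.m∸n≤m n k)
      ... | i , P≡pi with Equivalence.from (conj τ σ (q τ σ i) (p τ σ i)) (i , refl)
      ... | j , conj-j =
        suc (toℕ j) , s≤s z≤n , FinP.toℕ<n j ,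
        trans (at-toℕ (p (ρ τ) σ) j) (trans (cong proj₁ conj-j) (cong (λ x → w - x) (sym P≡pi)))

      P[ρτ]⊆reflected : ValuesOn (t (ρ τ) σ) (P X (ρ τ) σ) ⊆ ValuesOn n reflected
      P[ρτ]⊆reflected (suc k , _ , k<m , refl)
        with Equivalence.to (conj τ σ (p (ρ τ) σ (fromℕ< k<m)) (q (ρ τ) σ (fromℕ< k<m))) (fromℕ< k<m , refl)
      ... | i , conj-i =
        n ∸ toℕ i , ℕP.m<n⇒0<n∸m (FinP.toℕ<n i) , ℕP.m∸n≤m n (toℕ i) ,
        trans (cong (λ l → w - P X τ σ l) (suc[m]∸[m∸n]≡suc[n] (ℕP.<⇒≤ (FinP.toℕ<n i))))
          (trans (cong (λ x → w - x) (at-toℕ (p τ σ) i))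
            (trans (cong proj₂ conj-i) (sym (at-suc (p (ρ τ) σ) k<m))))

      P[ρτ]≡reflected : ∀ {i} → 1 ℕ.≤ i → i ℕ.≤ n → P X (ρ τ) σ i ≡ reflected i
      P[ρτ]≡reflected 1≤i i≤n = sym (proj₂ (strictlyIncreasing-unique reflected-strictlyIncreasing
        (P-strictlyIncreasing (ρ τ)) reflected⊆P[ρτ] P[ρτ]⊆reflected 1≤i i≤n))

    P[ρτ]-strictlyIncreasing : StrictlyIncreasingOn n (P X (ρ τ) σ)
    P[ρτ]-strictlyIncreasing 1≤i i<j j≤n =
      subst₂ _<_ (sym (P[ρτ]≡reflected 1≤i (ℕP.≤-trans (ℕP.<⇒≤ i<j) j≤n)))
                 (sym (P[ρτ]≡reflected (ℕP.≤-trans 1≤i (ℕP.<⇒≤ i<j)) j≤n))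
        (reflected-strictlyIncreasing 1≤i i<j j≤n)

    P[ρτ]≡Q-reflected : ∀ {i} → 1 ℕ.≤ i → i ℕ.≤ n → P X (ρ τ) σ i ≡ Q X τ σ (suc n ∸ i)
    P[ρτ]≡Q-reflected {suc k} 1≤i i≤n =
      trans (P[ρτ]≡reflected 1≤i i≤n) (sym (Q≡w-P (ℕP.m<n⇒0<n∸m i≤n) (ℕP.m∸n≤m n k)))

  P-conjugate-strictlyIncreasing : ∀ {τ τ₁} → τ₁ ∈ τ ∷ ρ τ ∷ [] →
    StrictlyIncreasingOn (t τ σ) (P X τ₁ σ)
  P-conjugate-strictlyIncreasing {τ} (here refl) = P-strictlyIncreasing τ
  P-conjugate-strictlyIncreasing {τ} (there (here refl)) = P[ρτ]-strictlyIncreasing τ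

  P-conjugates : ∀ {τ τ₁ n i i'} → τ₁ ∈ τ ∷ ρ τ ∷ [] →
    t τ σ ≡ n → 1 ℕ.≤ i → i ℕ.≤ n → suc n ∸ i ≡ i' →
    P X τ₁ σ i ≡ P X τ σ i ⊎ P X τ₁ σ i ≡ Q X τ σ i'
  P-conjugates (here refl) _ _ _ _ = inj₁ refl
  P-conjugates (there (here refl)) refl 1≤i i≤n refl = inj₂ (P[ρτ]≡Q-reflected _ 1≤i i≤n)

module _ {IF IE : Set} {ρ : IF → IF} (M N : PureMotive IF IE ρ) (τ : IF) (σ : IE)
  (tM≡1+tN : PureMotive.t M τ σ ≡ suc (tN M N τ σ)) (interlaced : StrongInterlace M N τ σ) where

  private
    t : ℕ
    t = tN M N τ σ
    q Q₀ : ℤ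
    q = qτσ M N τ σ
    Q₀ = proj₁ interlaced
    τs : List IF
    τs = τ ∷ ρ τ ∷ []

    sum≤-Q₀ : ∀ {τ₁ τ₂ k} → τ₁ ∈ τs → τ₂ ∈ τs → k ℕ.< t →
      P M τ₁ σ (t ∸ k) + P N τ₂ σ (suc k) ≤ - Q₀
    sum≤-Q₀ {k = k} τ₁∈ τ₂∈ k<t = ℤP.≤-trans
      (ℤP.+-mono-≤
        (x≡y⊎x≡z⇒x≤y⊔z (P-conjugates M σ τ₁∈ tM≡1+tN (ℕP.m<n⇒0<n∸m k<t) (ℕP.m≤n⇒m≤1+n (ℕP.m∸n≤m t k))
                          (suc[m]∸[m∸n]≡suc[n] (ℕP.m≤n⇒m≤1+n k<t))))
        (x≡y⊎x≡z⇒x≤y⊔z (P-conjugates N σ τ₂∈ refl (s≤s z≤n) k<t refl)))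
      (b+c≤-a⇒a+b≤-c (proj₂ (proj₂ interlaced (suc k) (s≤s z≤n) k<t)))

    -Q₀<sum : ∀ {τ₁ τ₂ k} → τ₁ ∈ τs → τ₂ ∈ τs → k ℕ.< t →
      - Q₀ < P M τ₁ σ (suc t ∸ k) + P N τ₂ σ (suc k)
    -Q₀<sum {k = k} τ₁∈ τ₂∈ k<t = ℤP.<-≤-trans
      (-a<b+c⇒-c<a+b (proj₁ (proj₂ interlaced (suc k) (s≤s z≤n) k<t)))
      (ℤP.+-mono-≤
        (x≡y⊎x≡z⇒y⊓z≤x (P-conjugates M σ τ₁∈ tM≡1+tN
                          (ℕP.m<n⇒0<n∸m (ℕP.m<n⇒m<1+n k<t)) (ℕP.m∸n≤m (suc t) k)
                          (suc[m]∸[m∸n]≡suc[n] (ℕP.m≤n⇒m≤1+n (ℕP.<⇒≤ k<t)))))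
        (x≡y⊎x≡z⇒y⊓z≤x (P-conjugates N σ τ₂∈ refl (s≤s z≤n) k<t refl)))

    sums : IF → IF → List ℤ
    sums τ₁ τ₂ = map (λ i → P M τ₁ σ (2 ℕ.+ t ∸ i) + P N τ₂ σ i) (range1 t)

    candidates : List ℤ
    candidates = concatMap (λ τ₁ → concatMap (sums τ₁) τs) τs

    ∈-candidates : ∀ {τ₁ τ₂ k} → τ₁ ∈ τs → τ₂ ∈ τs → k ℕ.< t →
      P M τ₁ σ (suc t ∸ k) + P N τ₂ σ (suc k) ∈ candidates
    ∈-candidates {τ₁} τ₁∈ τ₂∈ k<t = ∈-concatMap⁺ (λ τ' → concatMap (sums τ') τs)
      (lose τ₁∈ (∈-concatMap⁺ (sums τ₁) (lose τ₂∈ (∈-map⁺ _ (∈-range1⁺ k<t)))))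

    -Q₀<q : ∀ {k} → k ℕ.< t → - Q₀ < q
    -Q₀<q k<t = <-minList (∈-candidates (here refl) (here refl) k<t)
      (All-concatMap⁺ (λ τ₁ → concatMap (sums τ₁) τs) τs λ {τ₁} τ₁∈ →
        All-concatMap⁺ (sums τ₁) τs λ τ₂∈ → AllP.map⁺ (All-range1⁺ t (-Q₀<sum τ₁∈ τ₂∈)))

    block : IF → IF → List (ℤ × ℤ)
    block τ₁ τ₂ = grid (suc t) t (P M τ₁ σ) (P N τ₂ σ) (λ i j → Q M τ₁ σ i + Q N τ₂ σ j)

    block-balanced : ∀ {τ₁ τ₂} → τ₁ ∈ τs → τ₂ ∈ τs → Balanced q (block τ₁ τ₂)
    block-balanced {τ₁} {τ₂} τ₁∈ τ₂∈ = grid-balanced (λ i j → Q M τ₁ σ i + Q N τ₂ σ j)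
      (strictlyIncreasing⇒monotone (subst (λ n → StrictlyIncreasingOn n (P M τ₁ σ)) tM≡1+tN
        (P-conjugate-strictlyIncreasing M σ τ₁∈)))
      (λ k<t → ℤP.≤-<-trans (sum≤-Q₀ τ₁∈ τ₂∈ k<t) (-Q₀<q k<t) , minList-≤ (∈-candidates τ₁∈ τ₂∈ k<t))

  Hover-equalSplit : ∀ embs → (∀ {τ₁} → τ₁ ∈ embs → τ₁ ∈ τ ∷ ρ τ ∷ []) →
    EqualSplit M N τ σ (Hover M N τ σ embs)
  Hover-equalSplit embs ⊆τs = count<+count≥ q (Hover M N τ σ embs) ,
    concatMap-balanced q (λ τ₁ → concatMap (block τ₁) embs) embs (All.tabulate λ {τ₁} τ₁∈ →
      concatMap-balanced q (block τ₁) embs (All.tabulate λ τ₂∈ → block-balanced (⊆τs τ₁∈) (⊆τs τ₂∈)))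

-- The argument never uses whether τ is real or complex, nor that ρ is an involution.
lemma4p6 : {IF IE : Set} (ρ : IF → IF) → (∀ τ → ρ (ρ τ) ≡ τ) →
    (M N : PureMotive IF IE ρ) →
    (∀ τ σ → PureMotive.t M τ σ ≡ suc (PureMotive.t N τ σ)) →
    (τ : IF) (σ : IE) → StrongInterlace M N τ σ →
    (ρ τ ≡ τ → EqualSplit M N τ σ (Hreal M N τ σ))
    × (ρ τ ≢ τ → EqualSplit M N τ σ (Hcomplex M N τ σ))
lemma4p6 ρ _ M N tM≡1+tN τ σ interlaced =
  (λ _ → Hover-equalSplit M N τ σ (tM≡1+tN τ σ) interlaced (τ ∷ []) λ { (here refl) → here refl }) ,
  (λ _ → Hover-equalSplit M N τ σ (tM≡1+tN τ σ) interlaced (τ ∷ ρ τ ∷ []) id)
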